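{- Let $\mathit{Agt}$ be a finite set of agents, $T\notin\mathit{Agt}$ a further agent, and for each $i\in\mathit{Agt}$ let $i.m$ be a boolean expression. Let $M$ be a Kripke structure whose set of agents contains $\mathit{Agt}\cup\{T\}$ and at which the program $DC^a(m)$ is enabled. Then for every agent $i\in\mathit{Agt}$ and all worlds $u,v$ of $M[DC^a(m)]$ (which are exactly the worlds of $M$) we have $u\sim^{M[DC^a(m)]}_i v$ if and only if $u\sim^M_i v$ and $\pi^M(u,\oplus m)=\pi^M(v,\oplus m)$, where $\oplus m$ denotes the expression $\bigotimes_{j\in\mathit{Agt}} j.m$ (exclusive-or of all the agents' expressions).
   Context: Kripke structures. A Kripke structure is $M=(\mathit{Agt}^M,W,\{\sim_i\}_{i\in\mathit{Agt}^M},\mathit{Var},\pi)$ with a set of agents $\mathit{Agt}^M$, a set of worlds $W$, an equivalence relation $\sim_i$ on $W$ for each agent $i$, a set $\mathit{Var}$ of boolean variables and a valuation $\pi:W\times\mathit{Var}\to\{0,1\}$; $\pi(w,e)$ denotes the value of a boolean expression $e$ at $w$. We write $\sim^M_i$, $\pi^M$ for the components of $M$. Programs. All variables are boolean and belong to agents; $i.x$ denotes agent $i$'s variable $x$ ($i.x\ne j.x$ for $i\neq j$). In an atomic action of agent $i$, unindexed variable names refer to $i$'s variables, and $i.e$ denotes the expression $e$ with each unindexed variable $x$ replaced by $i.x$. Atomic actions: (1) $i: x:=e$ (reads the variables of $i.e$, writes $i.x$); (2) $i:\mathit{rand}(x)$ (reads nothing, writes $i.x$, assigning a nondeterministic value);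 (3) $i: e\rightarrow j.x$ (sends the value of $i.e$ over a private channel to $j$; reads variables of $i.e$, writes $j.x$); (4) $i:\mathit{broadcast}(x)$ (reads $i.x$, writes nothing). A joint action is a set of atomic actions in which no variable is written more than once ($\{\}$ is the empty joint action); a program is a sequence $A_1;\ldots;A_n$ of joint actions. If for each agent $i$, $P_i=A^i_1;\ldots;A^i_n$ is a program of common length $n$ containing only atomic actions of agent $i$, then $\|_i P_i=(\bigcup_iA^i_1);\ldots;(\bigcup_iA^i_n)$. An observability map $ov$ assigns each agent a set of variables. A joint action $A$ is enabled at $ov$ if no variable written by $A$ is in any $ov(i)$, for each $i:x:=e$ and $i:e\rightarrow j.x$ in $A$ all variables of $i.e$ are in $ov(i)$, and for each $i:\mathit{broadcast}(x)$ in $A$, $i.x\in ov(i)$. $ov[A](i)$ is $ov(i)$ together with every $i.x$ such that $A$ contains $i:x:=e$, $i:\mathit{rand}(x)$ or some $j:e\rightarrow i.x$, and every $j.x$ such that $A$ contains $j:\mathit{broadcast}(x)$. $A_1;\ldots;A_n$ is enabled at $ov$ if each $A_k$ is enabled at $ov[A_1]\cdots[A_{k-1}]$. $ov$ is consistent with $M$ if for all $i$, every $v\in ov(i)$ is in $\mathit{Var}$ and $\pi(w,v)=\pi(w',v)$ whenever $w\sim_iw'$. A program $P$ is enabled at $M$ if there is $ov$ consistent with $M$ at which $P$ is enabled and no variable written by $P$ is in $\mathit{Var}$. Semantics. For a joint action $A$ enabled at $M$, let $V_r$ be the set of $i.x$ with $i:\mathit{rand}(x)\in A$. $M[A]$ has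 the same agents, worlds $w+\kappa$ for $w\in W$, $\kappa:V_r\to\{0,1\}$ (just $w$ if $V_r=\emptyset$), variables $\mathit{Var}$ plus those written by $A$, valuation $\pi'$ with $\pi'(w+\kappa,v)=\pi(w,v)$ for $v\in\mathit{Var}$, $\pi'(w+\kappa,i.x)=\pi(w,i.e)$ if $i:x:=e\in A$, $=\kappa(i.x)$ if $i:\mathit{rand}(x)\in A$, $=\pi(w,j.e)$ if $j:e\rightarrow i.x\in A$; and $w+\kappa\sim'_iw'+\kappa'$ iff $w\sim_iw'$ and $\pi'(w+\kappa,x)=\pi'(w'+\kappa',x)$ for all $x\in ov[A](i)\setminus ov(i)$ (for any $ov$ consistent with $M$). For $P=A_1;\ldots;A_n$, $M[P]=M[A_1]\cdots[A_n]$. Abstract protocol. $\otimes$ is exclusive-or. For $i\in\mathit{Agt}$, $DC^a_i(m)$ is the program $\{i: m\rightarrow T.x_i\};\{\};\{\};\{i: rr:=T.y\}$, and $DC^a_T(m)$ is $\{\};\{T: y:=\bigotimes_{i\in\mathit{Agt}}x_i\};\{T:\mathit{broadcast}(y)\};\{\}$. $DC^a(m)=\|_{i\in\mathit{Agt}\cup\{T\}}DC^a_i(m)$. Since $DC^a(m)$ contains no $\mathit{rand}$ actions, $M[DC^a(m)]$ has the same worlds as $M$. -}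

module Defs where

open import Data.Nat using (ℕ)
open import Data.Bool using (Bool; true; false; not; _∧_; _∨_; _xor_; if_then_else_)
open import Data.List using (List; []; _∷_; _++_; map; foldr; zipWith; replicate)
open import Data.List.Membership.Propositional using (_∈_)
open import Data.List.Relation.Unary.Any using (Any)
open import Data.Product using (_×_; _,_; Σ; ∃)
open import Data.Sum using (_⊎_)
open import Data.Unit using (⊤)
open import Relation.Nullary using (¬_; Dec; yes; no)
open import Relation.Binary.PropositionalEquality using (_≡_; refl; cong; cong₂)
open import Relation.Binary.Structures using (IsEquivalence)
import Data.Nat.Properties as ℕP
import Data.Product.Properties as ×P

Agent : Set
Agent = ℕ

-- The protocol needs, for every agent
-- i, a name x_i (used as T.x_i), and the names y and rr; 'nm k' provides
-- arbitrarily many further names (e.g. for the expression m).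
data VName : Set where
  xv  : Agent → VName
  yv  : VName
  rrv : VName
  nm  : ℕ → VName

_≟V_ : (a b : VName) → Dec (a ≡ b)
xv i ≟V xv j with i ℕP.≟ j
... | yes refl = yes refl
... | no ne = no λ { refl → ne refl }
xv _ ≟V yv = no λ ()
xv _ ≟V rrv = no λ ()
xv _ ≟V nm _ = no λ ()
yv ≟V xv _ = no λ ()
yv ≟V yv = yes refl
yv ≟V rrv = no λ ()
yv ≟V nm _ = no λ ()
rrv ≟V xv _ = no λ ()
rrv ≟V yv = no λ ()
rrv ≟V rrv = yes refl
rrv ≟V nm _ = no λ ()
nm _ ≟V xv _ = no λ ()
nm _ ≟V yv = no λ ()
nm _ ≟V rrv = no λ ()
nm i ≟V nm j with i ℕP.≟ j
... | yes refl = yes refl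
... | no ne = no λ { refl → ne refl }

-- A (global) variable i.x is a pair (agent, local name).
Var : Set
Var = Agent × VName

_≟Var_ : (a b : Var) → Dec (a ≡ b)
_≟Var_ = ×P.≡-dec ℕP._≟_ _≟V_

data Expr (X : Set) : Set where
  var  : X → Expr X
  tt   : Expr X
  ff   : Expr X
  neg  : Expr X → Expr X
  _&_  : Expr X → Expr X → Expr X
  _∣∣_ : Expr X → Expr X → Expr X
  _⊗_  : Expr X → Expr X → Expr X

mapE : {X Y : Set} → (X → Y) → Expr X → Expr Y
mapE f (var x) = var (f x)
mapE f tt = tt
mapE f ff = ff
mapE f (neg e) = neg (mapE f e)
mapE f (e & e') = mapE f e & mapE f e'
mapE f (e ∣∣ e') = mapE f e ∣∣ mapE f e'
mapE f (e ⊗ e') = mapE f e ⊗ mapE f e'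

vars : {X : Set} → Expr X → List X
vars (var x) = x ∷ []
vars tt = []
vars ff = []
vars (neg e) = vars e
vars (e & e') = vars e ++ vars e'
vars (e ∣∣ e') = vars e ++ vars e'
vars (e ⊗ e') = vars e ++ vars e'

eval : {X : Set} → (X → Bool) → Expr X → Bool
eval ρ (var x) = ρ x
eval ρ tt = true
eval ρ ff = false
eval ρ (neg e) = not (eval ρ e)
eval ρ (e & e') = eval ρ e ∧ eval ρ e'
eval ρ (e ∣∣ e') = eval ρ e ∨ eval ρ e'
eval ρ (e ⊗ e') = eval ρ e xor eval ρ e'

bigXor : {X : Set} → List (Expr X) → Expr X
bigXor = foldr _⊗_ ff

-- Expressions occurring in atomic actions may mention unindexed
-- variables (of the acting agent) and indexed variables j.x.
data Ref : Set where
  local : VName → Ref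
  glob  : Var → Ref

_∙_ : Agent → Expr Ref → Expr Var
i ∙ e = mapE (λ { (local x) → (i , x) ; (glob v) → v }) e

data Atomic : Set where
  assign : Agent → VName → Expr Ref → Atomic
  send   : Agent → Expr Ref → Agent → VName → Atomic  -- i : e → j.x
  bcast  : Agent → VName → Atomic

JointAction : Set
JointAction = List Atomic

Program : Set
Program = List JointAction

Writes : Atomic → Var → Set
Writes (assign i x e) v = v ≡ (i , x)
Writes (send i e j x) v = v ≡ (j , x)
Writes (bcast i x) v = ⊥'
  where open import Data.Empty renaming (⊥ to ⊥')

WritesJ : JointAction → Var → Set
WritesJ A v = Any (λ a → Writes a v) A

WritesP : Program → Var → Set
WritesP P v = Any (λ A → WritesJ A v) P

ObsBy : Atomic → Agent → Var → Set
ObsBy (assign j x e) i v = (j ≡ i) × (v ≡ (i , x))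
ObsBy (send j e k x) i v = (k ≡ i) × (v ≡ (i , x))
ObsBy (bcast j x) i v = v ≡ (j , x)

NewObs : JointAction → Agent → Var → Set
NewObs A i v = Any (λ a → ObsBy a i v) A

ObsMap : Set₁
ObsMap = Agent → Var → Set

_⟦_⟧ : ObsMap → JointAction → ObsMap
(ov ⟦ A ⟧) i v = ov i v ⊎ NewObs A i v

EnabledAtomic : ObsMap → Atomic → Set
EnabledAtomic ov (assign i x e) = ∀ v → v ∈ vars (i ∙ e) → ov i v
EnabledAtomic ov (send i e j x) = ∀ v → v ∈ vars (i ∙ e) → ov i v
EnabledAtomic ov (bcast i x) = ov i (i , x)

EnabledJ : ObsMap → JointAction → Set
EnabledJ ov A =
  (∀ v → WritesJ A v → ∀ i → ¬ ov i v) ×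
  (∀ a → a ∈ A → EnabledAtomic ov a)

EnabledP : ObsMap → Program → Set
EnabledP ov [] = ⊤
EnabledP ov (A ∷ P) = EnabledJ ov A × EnabledP (ov ⟦ A ⟧) P

record Model (W : Set) : Set₁ where
  field
    Agts : Agent → Set
    Rel  : Agent → W → W → Set
    Vars : Var → Set
    π    : W → Var → Bool            -- valuation (only meaningful on Vars)

open Model public

IsKripke : {W : Set} → Model W → Set
IsKripke M = ∀ i → Agts M i → IsEquivalence (Rel M i)

Consistent : {W : Set} → Model W → ObsMap → Set
Consistent {W} M ov = ∀ i v → ov i v →
  Vars M v × (Agts M i → ∀ (w w' : W) → Rel M i w w' → π M w v ≡ π M w' v)

EnabledAt : {W : Set} → Model W → Program → Set₁
EnabledAt M P = Σ ObsMap λ ov →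
  Consistent M ov × EnabledP ov P × (∀ v → WritesP P v → ¬ Vars M v)

valAfter : JointAction → (Var → Bool) → Var → Bool
valAfter [] ρ v = ρ v
valAfter (assign i x e ∷ A) ρ v with (i , x) ≟Var v
... | yes _ = eval ρ (i ∙ e)
... | no  _ = valAfter A ρ v
valAfter (send i e j x ∷ A) ρ v with (j , x) ≟Var v
... | yes _ = eval ρ (i ∙ e)
... | no  _ = valAfter A ρ v
valAfter (bcast i x ∷ A) ρ v = valAfter A ρ v

step : {W : Set} → Model W → JointAction → Model W
step M A = record
  { Agts = Agts M
  ; Rel  = λ i w w' → Rel M i w w' ×
             (∀ v → NewObs A i v → valAfter A (π M w) v ≡ valAfter A (π M w') v)
  ; Vars = λ v → Vars M v ⊎ WritesJ A v
  ; π    = λ w → valAfter A (π M w)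
  }

run : {W : Set} → Model W → Program → Model W
run M [] = M
run M (A ∷ P) = run (step M A) P

-- ‖_i P_i for programs of common length 4
par : List Program → Program
par = foldr (zipWith _++_) (replicate 4 [])

DCa-i : Agent → Agent → Expr Ref → Program
DCa-i T i m =
  (send i m T (xv i) ∷ []) ∷
  [] ∷
  [] ∷
  (assign i rrv (var (glob (T , yv))) ∷ []) ∷ []

DCa-T : List Agent → Agent → Program
DCa-T Agt T =
  [] ∷
  (assign T yv (bigXor (map (λ i → var (local (xv i))) Agt)) ∷ []) ∷
  (bcast T yv ∷ []) ∷
  [] ∷ []

DCa : List Agent → Agent → Expr Ref → Program
DCa Agt T m = par (map (λ i → DCa-i T i m) Agt ++ DCa-T Agt T ∷ [])

xorM : List Agent → Expr Ref → Expr Var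
xorM Agt m = bigXor (map (λ j → j ∙ m) Agt)

module Submission where

-- The parallel composition DCa Agt T m unfolds to four
-- explicit rounds: every agent sends its m to T ('sends'), T computes
-- y := xor of the received bits ('tally'), T broadcasts y ('announce'),
-- and every agent copies T.y into rr ('readout').  In the semantics an
-- agent's accessibility relation after a round is the old one refined by
-- agreement on the variables that round newly shows the agent
-- ('Agrees').  For an agent i ≠ T the first two rounds show nothing,
-- the broadcast shows exactly T.y, and the readout shows i.rr, a copy of
-- T.y.  Hence the final relation of i is the original one refined by
-- agreement on T.y, and T.y equals ⊕m computed in the original world
-- ('tally-computes-xor').

open import Defs
open import Data.List using (List; _∷_; []; map; _++_)
open import Data.List.Membership.Propositional using (_∈_; _∉_)
open import Data.List.Relation.Unary.Unique.Propositional using (Unique)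
open import Data.List.Relation.Unary.Any using (here; there)
open import Data.Product using (_×_; _,_)
open import Data.Bool using (Bool; _xor_)
open import Data.Empty using (⊥-elim)
open import Relation.Nullary using (yes; no; ¬_)
open import Relation.Binary.PropositionalEquality
open import Function.Bundles using (_⇔_; mk⇔; Equivalence)

sends : Agent → Expr Ref → List Agent → JointAction
sends T m = map (λ i → send i m T (xv i))

tally : List Agent → Agent → JointAction
tally Agt T = assign T yv (bigXor (map (λ i → var (local (xv i))) Agt)) ∷ []

announce : Agent → JointAction
announce T = bcast T yv ∷ []

readout : Agent → List Agent → JointAction
readout T = map (λ i → assign i rrv (var (glob (T , yv))))

-- Normal form of the parallel composition.  The agent list of T's part
-- is kept separate from the senders' list so that induction works.
par-rounds : (Agt Agt' : List Agent) (T : Agent) (m : Expr Ref) →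
  par (map (λ i → DCa-i T i m) Agt ++ DCa-T Agt' T ∷ []) ≡
    sends T m Agt ∷ tally Agt' T ∷ announce T ∷ readout T Agt ∷ []
par-rounds []        Agt' T m = refl
par-rounds (j ∷ Agt) Agt' T m rewrite par-rounds Agt Agt' T m = refl

DCa-rounds : (Agt : List Agent) (T : Agent) (m : Expr Ref) →
  DCa Agt T m ≡ sends T m Agt ∷ tally Agt T ∷ announce T ∷ readout T Agt ∷ []
DCa-rounds Agt = par-rounds Agt Agt

-- Agreement of two pre-states ρ, ρ' on everything joint action A newly
-- shows agent i; 'step' refines ∼_i by exactly this condition.
Agrees : JointAction → Agent → (Var → Bool) → (Var → Bool) → Set
Agrees A i ρ ρ' = ∀ v → NewObs A i v → valAfter A ρ v ≡ valAfter A ρ' v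

assign-value : ∀ j x e A ρ → valAfter (assign j x e ∷ A) ρ (j , x) ≡ eval ρ (j ∙ e)
assign-value j x e A ρ with (j , x) ≟Var (j , x)
... | yes _ = refl
... | no ne = ⊥-elim (ne refl)

xv-injective : ∀ {a b c d : Agent} → (c , xv a) ≡ (d , xv b) → a ≡ b
xv-injective refl = refl

sends-value : ∀ T m (Agt : List Agent) ρ j → j ∈ Agt →
  valAfter (sends T m Agt) ρ (T , xv j) ≡ eval ρ (j ∙ m)
sends-value T m (k ∷ Agt) ρ j j∈ with (T , xv k) ≟Var (T , xv j)
... | yes p rewrite xv-injective p = refl
sends-value T m (k ∷ Agt) ρ j (here refl) | no ne = ⊥-elim (ne refl)
sends-value T m (k ∷ Agt) ρ j (there j∈) | no ne = sends-value T m Agt ρ j j∈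

xor-of-received : ∀ T m (Agt : List Agent) (ρ σ : Var → Bool) →
  (∀ j → j ∈ Agt → σ (T , xv j) ≡ eval ρ (j ∙ m)) →
  eval σ (T ∙ bigXor (map (λ i → var (local (xv i))) Agt)) ≡ eval ρ (xorM Agt m)
xor-of-received T m []        ρ σ received = refl
xor-of-received T m (j ∷ Agt) ρ σ received =
  cong₂ _xor_ (received j (here refl))
              (xor-of-received T m Agt ρ σ (λ k k∈ → received k (there k∈)))

tally-computes-xor : ∀ T m Agt ρ →
  valAfter (tally Agt T) (valAfter (sends T m Agt) ρ) (T , yv) ≡ eval ρ (xorM Agt m)
tally-computes-xor T m Agt ρ =
  trans (assign-value T yv _ [] _)
        (xor-of-received T m Agt ρ _ (sends-value T m Agt ρ))

readout-value : ∀ T (Agt : List Agent) ρ i → i ∈ Agt →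
  valAfter (readout T Agt) ρ (i , rrv) ≡ ρ (T , yv)
readout-value T (k ∷ Agt) ρ i i∈ with (k , rrv) ≟Var (i , rrv)
... | yes _ = refl
readout-value T (k ∷ Agt) ρ i (here refl) | no ne = ⊥-elim (ne refl)
readout-value T (k ∷ Agt) ρ i (there i∈) | no ne = readout-value T Agt ρ i i∈

sends-hidden : ∀ T m (Agt : List Agent) i v → ¬ T ≡ i → ¬ NewObs (sends T m Agt) i v
sends-hidden T m (k ∷ Agt) i v T≢i (here (T≡i , _)) = T≢i T≡i
sends-hidden T m (k ∷ Agt) i v T≢i (there obs) = sends-hidden T m Agt i v T≢i obs

sends-silent : ∀ T m (Agt : List Agent) i → ¬ T ≡ i →
  ∀ ρ ρ' → Agrees (sends T m Agt) i ρ ρ'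
sends-silent T m Agt i T≢i ρ ρ' v obs = ⊥-elim (sends-hidden T m Agt i v T≢i obs)

tally-silent : ∀ Agt T i → ¬ T ≡ i → ∀ ρ ρ' → Agrees (tally Agt T) i ρ ρ'
tally-silent Agt T i T≢i ρ ρ' v (here (T≡i , _)) = ⊥-elim (T≢i T≡i)

announce-agrees : ∀ T i ρ ρ' → Agrees (announce T) i ρ ρ' ⇔ ρ (T , yv) ≡ ρ' (T , yv)
announce-agrees T i ρ ρ' = mk⇔ (λ agree → agree (T , yv) (here refl))
                               (λ { same .(T , yv) (here refl) → same })

readout-shows-rr : ∀ T (Agt : List Agent) i v →
  NewObs (readout T Agt) i v → v ≡ (i , rrv)
readout-shows-rr T (k ∷ Agt) i v (here (_ , v≡)) = v≡
readout-shows-rr T (k ∷ Agt) i v (there obs) = readout-shows-rr T Agt i v obs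

readout-agrees : ∀ T Agt i → i ∈ Agt → ∀ ρ ρ' →
  ρ (T , yv) ≡ ρ' (T , yv) → Agrees (readout T Agt) i ρ ρ'
readout-agrees T Agt i i∈ ρ ρ' same v obs rewrite readout-shows-rr T Agt i v obs =
  trans (readout-value T Agt ρ i i∈) (trans same (sym (readout-value T Agt ρ' i i∈)))

lemma2 : (Agt : List Agent) → Unique Agt → (T : Agent) → T ∉ Agt →
    (m : Expr Ref) → {W : Set} → (M : Model W) → IsKripke M →
    (∀ i → i ∈ T ∷ Agt → Agts M i) → EnabledAt M (DCa Agt T m) →
    ∀ i → i ∈ Agt → ∀ (u v : W) →
    Rel (run M (DCa Agt T m)) i u v ⇔
    (Rel M i u v × eval (π M u) (xorM Agt m) ≡ eval (π M v) (xorM Agt m))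
lemma2 Agt _ T T∉Agt m {W} M _ _ _ i i∈ u v rewrite DCa-rounds Agt T m =
  mk⇔ to from
  where
  T≢i : ¬ T ≡ i
  T≢i refl = T∉Agt i∈

  T-y-is-⊕m : ∀ w →
    valAfter (tally Agt T) (valAfter (sends T m Agt) (π M w)) (T , yv) ≡
      eval (π M w) (xorM Agt m)
  T-y-is-⊕m w = tally-computes-xor T m Agt (π M w)

  to : Rel (run M (sends T m Agt ∷ tally Agt T ∷ announce T ∷ readout T Agt ∷ [])) i u v →
       Rel M i u v × eval (π M u) (xorM Agt m) ≡ eval (π M v) (xorM Agt m)
  to ((((u∼v , _) , _) , announced) , _) =
    u∼v , trans (sym (T-y-is-⊕m u))
                (trans (Equivalence.to (announce-agrees T i _ _) announced) (T-y-is-⊕m v))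

  from : Rel M i u v × eval (π M u) (xorM Agt m) ≡ eval (π M v) (xorM Agt m) →
         Rel (run M (sends T m Agt ∷ tally Agt T ∷ announce T ∷ readout T Agt ∷ [])) i u v
  from (u∼v , same⊕m) =
    (((u∼v , sends-silent T m Agt i T≢i _ _) , tally-silent Agt T i T≢i _ _)
      , Equivalence.from (announce-agrees T i _ _) sameY)
      , readout-agrees T Agt i i∈ _ _ sameY
    where
    sameY : valAfter (tally Agt T) (valAfter (sends T m Agt) (π M u)) (T , yv) ≡
            valAfter (tally Agt T) (valAfter (sends T m Agt) (π M v)) (T , yv)
    sameY = trans (T-y-is-⊕m u) (trans same⊕m (sym (T-y-is-⊕m v)))
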